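{- The functions $\pi$ and $\varphi$, extended to $\mathbb Z$ by $g(-n)=g(n)$ and $g(0)=0$, are height functions on $\mathbb Z$.
   Context: $\pi(n)$ is the number of primes less than $n$ and $\varphi(n)=|\{1\le k\le n:\gcd(k,n)=1\}|$, for $n\ge1$. A function $h:\mathbb Z\to[0,\infty)$ is a height function if there is $\theta:\mathbb N\to\mathbb N$ such that for all $x,y\in\mathbb Z$ and $n\in\mathbb N$ with $h(x)\le n$, $h(y)\le n$ one has $h(x+y)\le\theta(n)$ and $h(xy)\le\theta(n)$. -}

module Defs where

open import Data.Nat using (ℕ; zero; suc; _≤_; _≟_)
open import Data.Nat.GCD using (gcd)
open import Data.Nat.Primality using (prime?)
open import Data.Integer using (ℤ; +_; -[1+_]) renaming (_+_ to _+ℤ_; _*_ to _*ℤ_)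
open import Data.Product using (Σ; _×_)
open import Relation.Nullary using (Dec; yes; no)

-- π n = number of primes p with p < n
primeCount : ℕ → ℕ
primeCount zero = zero
primeCount (suc n) with prime? n
... | yes _ = suc (primeCount n)
... | no  _ = primeCount n

coprimeCountUpTo : ℕ → ℕ → ℕ
coprimeCountUpTo n zero = zero
coprimeCountUpTo n (suc m) with gcd (suc m) n ≟ 1
... | yes _ = suc (coprimeCountUpTo n m)
... | no  _ = coprimeCountUpTo n m

totient : ℕ → ℕ
totient n = coprimeCountUpTo n n

extend : (ℕ → ℕ) → ℤ → ℕ
extend g (+ zero)    = zero
extend g (+ suc n)   = g (suc n)
extend g -[1+ n ]    = g (suc n)

-- height function on ℤ (values in ℕ ⊆ [0,∞))
IsHeightFunction : (ℤ → ℕ) → Set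
IsHeightFunction h =
  Σ (ℕ → ℕ) λ θ → ∀ (x y : ℤ) (n : ℕ) → h x ≤ n → h y ≤ n →
    (h (x +ℤ y) ≤ θ n) × (h (x *ℤ y) ≤ θ n)

-- A function h with h z ≤ |z| whose sublevel sets {h ≤ n} are bounded, say by B n, is a
-- height function with θ n = B n ^ 2 + 2 B n.  For π the sublevel sets are bounded because
-- π is monotone and unbounded: a prime factor of m ! + 1 exceeds m (Euclid).  For φ, if
-- m = p r with p prime then among the p numbers 1 + j r ≤ m (j < p) only one can fail to be
-- coprime to m, so p ≤ φ m + 1.  Hence φ m ≤ n forces every prime factor of m to divide
-- g = gcd m ((n+1)!), and then the t = m / g numbers 1 + j g (j < t) are all coprime to m,
-- giving m = t g ≤ n (n+1)!.
module Submission where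

open import Defs
open import Data.Product using (_×_; _,_; ∃-syntax)
open import Data.Sum using (inj₁; inj₂)
open import Data.Nat
open import Data.Nat.Properties
open import Data.Nat.Divisibility
open import Data.Nat.GCD using (gcd; gcd[m,n]∣m; gcd[m,n]∣n; gcd-greatest; gcd[m,n]≤n; gcd[m,n]≢0)
open import Data.Nat.Primality
open import Data.Nat.Primality.Factorisation using (factorise)
open import Data.List using ([]; _∷_)
open import Data.List.Relation.Unary.All using (_∷_)
open import Data.Integer using (ℤ; +_; -[1+_]) renaming (_+_ to _+ℤ_; _*_ to _*ℤ_)
import Data.Integer as ℤ
open import Data.Integer.Properties using (∣i+j∣≤∣i∣+∣j∣; ∣i*j∣≡∣i∣*∣j∣)
open import Function using (_∘_)
open import Relation.Binary.Core using (_Preserves_⟶_)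
open import Relation.Binary.Definitions using (tri<; tri≈; tri>)
open import Relation.Nullary using (¬_; yes; no)
open import Relation.Nullary.Negation using (contradiction)
open import Relation.Nullary.Decidable using (decidable-stable)
open import Relation.Unary using (Pred; Decidable)
open import Relation.Binary.PropositionalEquality

private
  variable
    c j k m n p : ℕ

isHeightFunction : (h : ℤ → ℕ) (B : ℕ → ℕ) →
                   (∀ z → h z ≤ ℤ.∣ z ∣) → (∀ {z n} → h z ≤ n → ℤ.∣ z ∣ ≤ B n) →
                   IsHeightFunction h
isHeightFunction h B h≤∣∣ bounded = θ , λ x y n hx≤n hy≤n →
    ≤-trans (h≤∣∣ (x +ℤ y)) (begin
      ℤ.∣ x +ℤ y ∣       ≤⟨ ∣i+j∣≤∣i∣+∣j∣ x y ⟩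
      ℤ.∣ x ∣ + ℤ.∣ y ∣  ≤⟨ +-mono-≤ (bounded {x} hx≤n) (bounded {y} hy≤n) ⟩
      B n + B n          ≤⟨ m≤n+m (B n + B n) (B n * B n) ⟩
      θ n                ∎)
  , ≤-trans (h≤∣∣ (x *ℤ y)) (begin
      ℤ.∣ x *ℤ y ∣       ≡⟨ ∣i*j∣≡∣i∣*∣j∣ x y ⟩
      ℤ.∣ x ∣ * ℤ.∣ y ∣  ≤⟨ *-mono-≤ (bounded {x} hx≤n) (bounded {y} hy≤n) ⟩
      B n * B n          ≤⟨ m≤m+n (B n * B n) (B n + B n) ⟩
      θ n                ∎)
  where
  open ≤-Reasoning
  θ : ℕ → ℕ
  θ n = B n * B n + (B n + B n)

extend-isHeightFunction : (g : ℕ → ℕ) (B : ℕ → ℕ) → (∀ k → g k ≤ k) →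
                          (∀ {k n} .{{_ : NonZero k}} → g k ≤ n → k ≤ B n) →
                          IsHeightFunction (extend g)
extend-isHeightFunction g B g≤id bounded =
  isHeightFunction (extend g) B extend≤∣∣ (λ {z} → extend-bounded {z})
  where
  extend≤∣∣ : ∀ z → extend g z ≤ ℤ.∣ z ∣
  extend≤∣∣ (+ zero)  = z≤n
  extend≤∣∣ (+ suc k) = g≤id (suc k)
  extend≤∣∣ -[1+ k ]  = g≤id (suc k)

  extend-bounded : ∀ {z n} → extend g z ≤ n → ℤ.∣ z ∣ ≤ B n
  extend-bounded {+ zero}    _    = z≤n
  extend-bounded {+ suc k}   gz≤n = bounded gz≤n
  extend-bounded { -[1+ k ]} gz≤n = bounded gz≤n

sublevel-bounded : ∀ {g b} → g Preserves _≤_ ⟶ _≤_ → n < g b → g k ≤ n → k < b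
sublevel-bounded mono n<gb gk≤n = ≰⇒> λ b≤k → <⇒≱ n<gb (≤-trans (mono b≤k) gk≤n)

count : ∀ {ℓ} {P : Pred ℕ ℓ} → Decidable P → ℕ → ℕ
count P? zero = zero
count P? (suc n) with P? n
... | yes _ = suc (count P? n)
... | no  _ = count P? n

module _ {ℓ} {P : Pred ℕ ℓ} (P? : Decidable P) where

  count-yes : P n → count P? (suc n) ≡ suc (count P? n)
  count-yes {n} Pn with P? n
  ... | yes _  = refl
  ... | no ¬Pn = contradiction Pn ¬Pn

  count-suc : ∀ n → count P? n ≤ count P? (suc n)
  count-suc n with P? n
  ... | yes _ = n≤1+n _
  ... | no  _ = ≤-refl

  count≤ : ∀ n → count P? n ≤ n
  count≤ zero = z≤n
  count≤ (suc n) with P? n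
  ... | yes _ = s≤s (count≤ n)
  ... | no  _ = m≤n⇒m≤1+n (count≤ n)

  count-mono : count P? Preserves _≤_ ⟶ _≤_
  count-mono m≤n = go (≤⇒≤′ m≤n)
    where
    go : m ≤′ n → count P? m ≤ count P? n
    go ≤′-refl          = ≤-refl
    go (≤′-step {n} m≤n) = ≤-trans (go m≤n) (count-suc n)

  count-all : (∀ {j} → j < n → P j) → count P? n ≡ n
  count-all {zero}  _   = refl
  count-all {suc n} all = trans (count-yes (all ≤-refl)) (cong suc (count-all (all ∘ m≤n⇒m≤1+n)))

  count-allButOne : (∀ {j k} → j < n → k < n → ¬ P j → ¬ P k → j ≡ k) → n ≤ suc (count P? n)
  count-allButOne {zero}  _ = z≤n
  count-allButOne {suc n} unique with P? n
  ... | yes _  = s≤s (count-allButOne λ j<n k<n → unique (m≤n⇒m≤1+n j<n) (m≤n⇒m≤1+n k<n))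
  ... | no ¬Pn = s≤s (≤-reflexive (sym (count-all λ {j} j<n →
      decidable-stable (P? j) λ ¬Pj → <-irrefl (unique (m≤n⇒m≤1+n j<n) ≤-refl ¬Pj ¬Pn) j<n)))

  count-∘-≤ : ∀ {f} → f Preserves _<_ ⟶ _<_ → (∀ {j} → j < c → f j < m) →
              count (P? ∘ f) c ≤ count P? m
  count-∘-≤ {zero}              _    _   = z≤n
  count-∘-≤ {suc c} {m} {f} mono f<m with P? (f c)
  ... | yes Pfc = begin
      suc (count (P? ∘ f) c) ≤⟨ s≤s (count-∘-≤ mono mono) ⟩
      suc (count P? (f c))   ≡⟨ count-yes Pfc ⟨
      count P? (suc (f c))   ≤⟨ count-mono (f<m ≤-refl) ⟩
      count P? m             ∎
    where open ≤-Reasoning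
  ... | no _ = ≤-trans (count-∘-≤ mono mono) (count-mono (<⇒≤ (f<m ≤-refl)))

prime⇒∤1 : Prime p → ¬ p ∣ 1
prime⇒∤1 {p} p-prime p∣1 = ¬prime[1] (subst Prime (∣1⇒≡1 p∣1) p-prime)

prime∣1+n⇒∤n : Prime p → p ∣ suc n → ¬ p ∣ n
prime∣1+n⇒∤n {p} {n} p-prime p∣1+n p∣n =
  prime⇒∤1 p-prime (∣m+n∣m⇒∣n (subst (p ∣_) (+-comm 1 n) p∣1+n) p∣n)

prime∣1+j*r⇒∤r : ∀ {r} → Prime p → p ∣ suc (j * r) → ¬ p ∣ r
prime∣1+j*r⇒∤r {j = j} p-prime p∣1+jr = prime∣1+n⇒∤n p-prime p∣1+jr ∘ ∣n⇒∣m*n j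

≢1⇒∃prime∣ : ∀ n → n ≢ 1 → ∃[ p ] Prime p × p ∣ n
≢1⇒∃prime∣ zero    _   = 2 , prime[2] , (2 ∣0)
≢1⇒∃prime∣ (suc n) n≢1 with factorise (suc n)
... | record { factors = [] ; isFactorisation = eq } = contradiction eq n≢1
... | record { factors = p ∷ ps ; isFactorisation = eq ; factorsPrime = p-prime ∷ _ } =
  p , p-prime , subst (p ∣_) (sym eq) (m∣m*n _)

gcd≢1⇒∃commonPrime : gcd m n ≢ 1 → ∃[ p ] Prime p × p ∣ m × p ∣ n
gcd≢1⇒∃commonPrime {m} {n} gcd≢1 with ≢1⇒∃prime∣ (gcd m n) gcd≢1
... | p , p-prime , p∣gcd =
  p , p-prime , ∣-trans p∣gcd (gcd[m,n]∣m m n) , ∣-trans p∣gcd (gcd[m,n]∣n m n)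

noCommonPrime⇒gcd≡1 : (∀ {p} → Prime p → p ∣ m → ¬ p ∣ n) → gcd m n ≡ 1
noCommonPrime⇒gcd≡1 {m} {n} noCommon with gcd m n ≟ 1
... | yes gcd≡1 = gcd≡1
... | no  gcd≢1 with gcd≢1⇒∃commonPrime gcd≢1
...   | _ , p-prime , p∣m , p∣n = contradiction p∣n (noCommon p-prime p∣m)

∣n! : .{{NonZero p}} → p ≤ n → p ∣ n !
∣n! {suc p} p≤n = ∣-trans (m∣m*n (p !)) (m≤n⇒m!∣n! p≤n)

primeCount≡count : ∀ n → primeCount n ≡ count prime? n
primeCount≡count zero = refl
primeCount≡count (suc n) with prime? n
... | yes _ = cong suc (primeCount≡count n)
... | no  _ = primeCount≡count n

primeCount≤id : ∀ n → primeCount n ≤ n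
primeCount≤id n = subst (_≤ n) (sym (primeCount≡count n)) (count≤ prime? n)

primeCount-mono : primeCount Preserves _≤_ ⟶ _≤_
primeCount-mono {m} {n} m≤n =
  subst₂ _≤_ (sym (primeCount≡count m)) (sym (primeCount≡count n)) (count-mono prime? m≤n)

primeCount-suc-prime : Prime p → primeCount (suc p) ≡ suc (primeCount p)
primeCount-suc-prime {p} p-prime = begin
  primeCount (suc p)      ≡⟨ primeCount≡count (suc p) ⟩
  count prime? (suc p)    ≡⟨ count-yes prime? p-prime ⟩
  suc (count prime? p)    ≡⟨ cong suc (primeCount≡count p) ⟨
  suc (primeCount p)      ∎
  where open ≡-Reasoning

∃prime-between-n-and-1+n! : ∀ n → ∃[ p ] Prime p × n < p × p ≤ suc (n !)
∃prime-between-n-and-1+n! n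
  with ≢1⇒∃prime∣ (suc (n !)) (≢-nonZero⁻¹ (n !) {{n !≢0}} ∘ suc-injective)
... | p , p-prime , p∣1+n! = p , p-prime , n<p , ∣⇒≤ p∣1+n!
  where
  instance
    p≢0 : NonZero p
    p≢0 = prime⇒nonZero p-prime
  n<p : n < p
  n<p = ≰⇒> λ p≤n → prime∣1+n⇒∤n p-prime p∣1+n! (∣n! p≤n)

primeCount[2+n!]>primeCount : ∀ n → primeCount n < primeCount (2 + n !)
primeCount[2+n!]>primeCount n with ∃prime-between-n-and-1+n! n
... | p , p-prime , n<p , p≤1+n! = begin-strict
  primeCount n          ≤⟨ primeCount-mono (<⇒≤ n<p) ⟩
  primeCount p          <⟨ n<1+n _ ⟩
  suc (primeCount p)    ≡⟨ primeCount-suc-prime p-prime ⟨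
  primeCount (suc p)    ≤⟨ primeCount-mono (s≤s p≤1+n!) ⟩
  primeCount (2 + n !)  ∎
  where open ≤-Reasoning

euclidTower : ℕ → ℕ
euclidTower zero    = zero
euclidTower (suc k) = 2 + euclidTower k !

id≤primeCount∘euclidTower : ∀ k → k ≤ primeCount (euclidTower k)
id≤primeCount∘euclidTower zero    = z≤n
id≤primeCount∘euclidTower (suc k) =
  ≤-trans (s≤s (id≤primeCount∘euclidTower k)) (primeCount[2+n!]>primeCount (euclidTower k))

primeCount≤⇒≤ : primeCount k ≤ n → k ≤ euclidTower (suc n)
primeCount≤⇒≤ {n = n} πk≤n =
  <⇒≤ (sublevel-bounded primeCount-mono (id≤primeCount∘euclidTower (suc n)) πk≤n)

-- Index k stands for the integer k + 1, matching the range 1 ≤ k ≤ m of coprimeCountUpTo.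
coprimeSuc? : ∀ m → Decidable (λ k → gcd (suc k) m ≡ 1)
coprimeSuc? m k = gcd (suc k) m ≟ 1

coprimeCountUpTo≡count : ∀ m n → coprimeCountUpTo m n ≡ count (coprimeSuc? m) n
coprimeCountUpTo≡count m zero = refl
coprimeCountUpTo≡count m (suc n) with gcd (suc n) m ≟ 1
... | yes _ = cong suc (coprimeCountUpTo≡count m n)
... | no  _ = coprimeCountUpTo≡count m n

totient≤id : ∀ m → totient m ≤ m
totient≤id m = subst (_≤ m) (sym (coprimeCountUpTo≡count m m)) (count≤ (coprimeSuc? m) m)

count-progression≤totient : ∀ c r .{{_ : NonZero r}} → m ≡ c * r →
                            count (coprimeSuc? m ∘ (_* r)) c ≤ totient m
count-progression≤totient {m} c r m≡c*r =
  subst (count (coprimeSuc? m ∘ (_* r)) c ≤_) (sym (coprimeCountUpTo≡count m m))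
    (count-∘-≤ (coprimeSuc? m) {c} (*-monoˡ-< r) λ j<c →
      subst (_ <_) (sym m≡c*r) (*-monoˡ-< r j<c))

gcd[1+j*r,p*r]≢1⇒p∣1+j*r : ∀ {r} → Prime p → gcd (suc (j * r)) (p * r) ≢ 1 → p ∣ suc (j * r)
gcd[1+j*r,p*r]≢1⇒p∣1+j*r {p} {j} {r = r} p-prime gcd≢1 with gcd≢1⇒∃commonPrime gcd≢1
... | q , q-prime , q∣1+jr , q∣pr with euclidsLemma p r q-prime q∣pr
...   | inj₂ q∣r = contradiction q∣r (prime∣1+j*r⇒∤r {j = j} q-prime q∣1+jr)
...   | inj₁ q∣p with prime⇒irreducible p-prime q∣p
...     | inj₁ q≡1 = contradiction (subst Prime q≡1 q-prime) ¬prime[1]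
...     | inj₂ q≡p = subst (_∣ suc (j * r)) q≡p q∣1+jr

∣1+j*r∧∣1+k*r⇒∣[k∸j]*r : ∀ {d r} → j ≤ k → d ∣ suc (j * r) → d ∣ suc (k * r) → d ∣ (k ∸ j) * r
∣1+j*r∧∣1+k*r⇒∣[k∸j]*r {j} {k} {d} {r} j≤k d∣1+jr d∣1+kr =
  ∣m+n∣m⇒∣n (subst (d ∣_) 1+kr≡1+jr+[k∸j]r d∣1+kr) d∣1+jr
  where
  open ≡-Reasoning
  1+kr≡1+jr+[k∸j]r : suc (k * r) ≡ suc (j * r) + (k ∸ j) * r
  1+kr≡1+jr+[k∸j]r = cong suc (begin
    k * r                 ≡⟨ cong (_* r) (m+[n∸m]≡n j≤k) ⟨
    (j + (k ∸ j)) * r     ≡⟨ *-distribʳ-+ r j (k ∸ j) ⟩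
    j * r + (k ∸ j) * r   ∎)

prime∣1+j*r⇒∤1+k*r : ∀ {r} → Prime p → j < k → k < p → p ∣ suc (j * r) → ¬ p ∣ suc (k * r)
prime∣1+j*r⇒∤1+k*r {p} {j} {k} {r} p-prime j<k k<p p∣1+jr p∣1+kr
  with euclidsLemma (k ∸ j) r p-prime (∣1+j*r∧∣1+k*r⇒∣[k∸j]*r (<⇒≤ j<k) p∣1+jr p∣1+kr)
... | inj₁ p∣k∸j = <⇒≱ k<p (≤-trans (∣⇒≤ {{>-nonZero (m<n⇒0<n∸m j<k)}} p∣k∸j) (m∸n≤m k j))
... | inj₂ p∣r   = prime∣1+j*r⇒∤r {j = j} p-prime p∣1+jr p∣r

prime∣1+j*r-unique : ∀ {r} → Prime p → j < p → k < p → p ∣ suc (j * r) → p ∣ suc (k * r) → j ≡ k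
prime∣1+j*r-unique {j = j} {k} p-prime j<p k<p p∣1+jr p∣1+kr with <-cmp j k
... | tri< j<k _ _ = contradiction p∣1+kr (prime∣1+j*r⇒∤1+k*r p-prime j<k k<p p∣1+jr)
... | tri≈ _ j≡k _ = j≡k
... | tri> _ _ k<j = contradiction p∣1+jr (prime∣1+j*r⇒∤1+k*r p-prime k<j j<p p∣1+kr)

prime∣⇒≤1+totient : ∀ {m p} .{{_ : NonZero m}} → Prime p → p ∣ m → p ≤ suc (totient m)
prime∣⇒≤1+totient {m} {p} p-prime (divides r m≡r*p) = begin
  p                                        ≤⟨ count-allButOne (coprimeSuc? m ∘ (_* r)) unique ⟩
  suc (count (coprimeSuc? m ∘ (_* r)) p)   ≤⟨ s≤s (count-progression≤totient p r m≡p*r) ⟩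
  suc (totient m)                          ∎
  where
  open ≤-Reasoning
  m≡p*r : m ≡ p * r
  m≡p*r = trans m≡r*p (*-comm r p)
  instance
    r≢0 : NonZero r
    r≢0 = ≢-nonZero λ r≡0 → ≢-nonZero⁻¹ m (trans m≡r*p (cong (_* p) r≡0))
  p∣1+jr : gcd (suc (j * r)) m ≢ 1 → p ∣ suc (j * r)
  p∣1+jr {j} =
    gcd[1+j*r,p*r]≢1⇒p∣1+j*r {j = j} p-prime ∘ subst (λ x → gcd (suc (j * r)) x ≢ 1) m≡p*r
  unique : j < p → k < p → gcd (suc (j * r)) m ≢ 1 → gcd (suc (k * r)) m ≢ 1 → j ≡ k
  unique {j} {k} j<p k<p ¬j ¬k = prime∣1+j*r-unique p-prime j<p k<p (p∣1+jr {j} ¬j) (p∣1+jr {k} ¬k)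

m≤totient[m]*g : ∀ {g m} .{{_ : NonZero g}} → g ∣ m → (∀ {p} → Prime p → p ∣ m → p ∣ g) →
                 m ≤ totient m * g
m≤totient[m]*g {g} {m} (divides t m≡t*g) primes∣g = begin
  m                                     ≡⟨ m≡t*g ⟩
  t * g                                 ≡⟨ cong (_* g) (count-all (coprimeSuc? m ∘ (_* g)) coprime) ⟨
  count (coprimeSuc? m ∘ (_* g)) t * g  ≤⟨ *-monoˡ-≤ g (count-progression≤totient t g m≡t*g) ⟩
  totient m * g                         ∎
  where
  open ≤-Reasoning
  coprime : j < t → gcd (suc (j * g)) m ≡ 1
  coprime {j} _ = noCommonPrime⇒gcd≡1 λ p-prime p∣1+jg p∣m →
    prime∣1+j*r⇒∤r {j = j} p-prime p∣1+jg (primes∣g p-prime p∣m)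

totient≤⇒≤ : .{{NonZero m}} → totient m ≤ n → m ≤ n * suc n !
totient≤⇒≤ {m} {n} φm≤n = begin
  m                  ≤⟨ m≤totient[m]*g (gcd[m,n]∣m m (suc n !)) primes∣g ⟩
  totient m * g      ≤⟨ *-mono-≤ φm≤n (gcd[m,n]≤n m (suc n !) {{suc n !≢0}}) ⟩
  n * suc n !        ∎
  where
  open ≤-Reasoning
  g : ℕ
  g = gcd m (suc n !)
  instance
    g≢0 : NonZero g
    g≢0 = ≢-nonZero (gcd[m,n]≢0 m (suc n !) (inj₁ (≢-nonZero⁻¹ m)))
  primes∣g : Prime p → p ∣ m → p ∣ g
  primes∣g p-prime p∣m = gcd-greatest p∣m
    (∣n! {{prime⇒nonZero p-prime}} (≤-trans (prime∣⇒≤1+totient p-prime p∣m) (s≤s φm≤n)))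

corollary5p8 : IsHeightFunction (extend primeCount) × IsHeightFunction (extend totient)
corollary5p8 =
    extend-isHeightFunction primeCount (euclidTower ∘ suc) primeCount≤id
      (λ πk≤n → primeCount≤⇒≤ πk≤n)
  , extend-isHeightFunction totient (λ n → n * suc n !) totient≤id totient≤⇒≤
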